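{- Let $P$ be a finite poset with minimum $\hat0$ and maximum $\hat1$, let $M$ be a special partial matching on $P$, and define $\pi:[\hat0,M(\hat1)]\times\mathbf{2}\to P$ by $\pi(p,\gamma)=M(p)$ if $\gamma=\beta$ and $p\lessdot M(p)$, and $\pi(p,\gamma)=p$ otherwise. Then $\pi$ is an order projection, and $P$ is isomorphic to the fibre poset of $\pi$.
   Context: $\mathbf{2}=\{\alpha<\beta\}$ and $\lessdot$ is the cover relation. An SPM on $P$ is $M:P\to P$ with $M^2=\mathrm{id}$; $M(\hat1)\lessdot\hat1$; for all $x$, $M(x)\lessdot x$, $M(x)=x$, or $x\lessdot M(x)$; and if $x\lessdot y$ and $M(x)\neq y$ then $M(x)<M(y)$. An order-preserving map $\pi:Q\to P'$ is an order projection if for every $x'\leq y'$ in $P'$ there exist $x\leq y$ in $Q$ with $\pi(x)=x'$, $\pi(y)=y'$. Its fibre poset has as elements the fibres $\pi^{ -1}(x')$, $x'\in P'$, with $F_1\leq F_2$ iff $x\leq y$ for some $x\in F_1$, $y\in F_2$. -}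

module Defs where

open import Level using (0ℓ)
open import Data.Nat using (ℕ)
open import Data.Fin using (Fin)
open import Data.Fin.Properties using (all?)
open import Data.Product using (Σ; ∃; _×_; _,_; proj₁)
open import Data.Sum using (_⊎_)
open import Relation.Nullary using (¬_; Dec; yes; no; _×-dec_; ¬?)
open import Relation.Binary.PropositionalEquality using (_≡_; _≢_)
open import Data.Fin.Properties using () renaming (_≟_ to _≟F_)

record FinPoset (n : ℕ) : Set₁ where
  field
    _≤_     : Fin n → Fin n → Set
    _≤?_    : (x y : Fin n) → Dec (x ≤ y)
    refl    : ∀ x → x ≤ x
    trans   : ∀ {x y z} → x ≤ y → y ≤ z → x ≤ z
    antisym : ∀ {x y} → x ≤ y → y ≤ x → x ≡ y

  _<_ : Fin n → Fin n → Set
  x < y = x ≤ y × x ≢ y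

  _<?_ : (x y : Fin n) → Dec (x < y)
  x <? y = (x ≤? y) ×-dec ¬? (x ≟F y)

  _⋖_ : Fin n → Fin n → Set
  x ⋖ y = x < y × (∀ z → ¬ (x < z × z < y))

  _⋖?_ : (x y : Fin n) → Dec (x ⋖ y)
  x ⋖? y = (x <? y) ×-dec all? (λ z → ¬? ((x <? z) ×-dec (z <? y)))

  IsMinimum : Fin n → Set
  IsMinimum b = ∀ x → b ≤ x

  IsMaximum : Fin n → Set
  IsMaximum t = ∀ x → x ≤ t

module _ {n : ℕ} (P : FinPoset n) where
  open FinPoset P

  record IsSPM (one : Fin n) (M : Fin n → Fin n) : Set where
    field
      involution : ∀ x → M (M x) ≡ x
      top        : M one ⋖ one
      trichot    : ∀ x → M x ⋖ x ⊎ M x ≡ x ⊎ x ⋖ M x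
      special    : ∀ x y → x ⋖ y → M x ≢ y → M x < M y

data Two : Set where
  α β : Two

data _≤₂_ : Two → Two → Set where
  α≤α : α ≤₂ α
  α≤β : α ≤₂ β
  β≤β : β ≤₂ β

module Projection {n : ℕ} (P : FinPoset n) (M : Fin n → Fin n) (one : Fin n) where
  open FinPoset P

  -- the interval [0̂, M(1̂)]  (0̂ is the minimum, so this is the down-set of M(1̂))
  Interval : Set
  Interval = Σ (Fin n) (λ p → p ≤ M one)

  Q : Set
  Q = Interval × Two

  _≤Q_ : Q → Q → Set
  ((p , _) , γ) ≤Q ((q , _) , δ) = p ≤ q × γ ≤₂ δ

  π : Q → Fin n
  π ((p , _) , β) with p ⋖? M p
  ... | yes _ = M p
  ... | no  _ = p
  π ((p , _) , α) = p

record IsOrderProjection {n : ℕ} (P : FinPoset n) {Q : Set} (_≤Q_ : Q → Q → Set)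
                         (f : Q → Fin n) : Set where
  open FinPoset P
  field
    monotone : ∀ {x y} → x ≤Q y → f x ≤ f y
    lift     : ∀ x' y' → x' ≤ y' →
               Σ Q (λ x → Σ Q (λ y → x ≤Q y × f x ≡ x' × f y ≡ y'))

-- The fibre poset of f, with its elements (the fibres f⁻¹(x')) indexed by x' ∈ P:
--   f⁻¹(x') ≤ f⁻¹(y')  iff  x ≤Q y for some x ∈ f⁻¹(x'), y ∈ f⁻¹(y').
FibreLe : {n : ℕ} {Q : Set} (_≤Q_ : Q → Q → Set) (f : Q → Fin n) →
          Fin n → Fin n → Set
FibreLe _≤Q_ f x' y' = Σ _ (λ x → Σ _ (λ y → f x ≡ x' × f y ≡ y' × x ≤Q y))

Fibre : {n : ℕ} {Q : Set} (f : Q → Fin n) → Fin n → Q → Set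
Fibre f x' q = f q ≡ x'

-- the map x' ↦ f⁻¹(x') is a bijection from P onto the set of fibres
-- (fibres are pairwise distinct as subsets of Q, i.e. distinct points have
-- non-equal fibres, and every fibre is nonempty)
record FibresFaithful {n : ℕ} {Q : Set} (f : Q → Fin n) : Set where
  field
    nonempty : ∀ x' → Σ Q (Fibre f x')
    distinct : ∀ x' y' → (∀ q → Fibre f x' q → Fibre f y' q) → x' ≡ y'

record FibreIso {n : ℕ} (P : FinPoset n) {Q : Set} (_≤Q_ : Q → Q → Set)
                (f : Q → Fin n) : Set where
  open FinPoset P
  field
    to      : Fin n → Fin n
    from    : Fin n → Fin n
    from-to : ∀ x → from (to x) ≡ x
    to-from : ∀ x → to (from x) ≡ x
    to-mono : ∀ x y → x ≤ y → FibreLe _≤Q_ f (to x) (to y)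
    to-refl : ∀ x y → FibreLe _≤Q_ f (to x) (to y) → x ≤ y

-- In a finite poset ≤ is the reflexive–transitive closure of ⋖, so a map is
-- monotone as soon as it is monotone on covers. The special-matching axiom says
-- exactly that the maps  up x = max {x, M x}  and  down x = min {x, M x}  are
-- monotone on covers, hence monotone. Now π(p, α) = p and π(p, β) = up p, which
-- makes π monotone. Since down 1̂ = M 1̂, every down x lies in [0̂, M 1̂], and x is
-- the image of (down x, γ) for a suitable γ; for x' ≤ y' with y' outside the
-- interval, (down x', γ) ≤ (M y', β) is a lift. Monotonicity and lifting say
-- that the fibre order is the order of P itself.
module Submission where

open import Defs
open import Data.Nat using (ℕ)
open import Data.Fin using (Fin)
open import Data.Fin.Properties using (¬∀⟶∃¬) renaming (_≟_ to _≟F_)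
open import Data.Fin.Induction using (po-wellFounded; po-noetherian)
open import Data.Product using (Σ; ∃; _×_; _,_; proj₁; proj₂)
open import Data.Sum using (_⊎_; inj₁; inj₂)
open import Data.Empty using (⊥-elim)
open import Function using (flip)
open import Induction.WellFounded using (Acc; acc)
open import Relation.Binary.Construct.Closure.ReflexiveTransitive
  using (Star; ε; _◅_; _◅◅_; fold)
open import Relation.Binary.PropositionalEquality
  using (_≡_; refl; sym; trans; subst; subst₂; cong; isEquivalence)
open import Relation.Binary.Structures using (IsPartialOrder)
open import Relation.Nullary using (¬_; Dec; yes; no; ¬?; _×-dec_)
open import Relation.Nullary.Decidable using (decidable-stable)

≤₂β : ∀ γ → γ ≤₂ β
≤₂β α = α≤β
≤₂β β = β≤β

module Covers {n : ℕ} (P : FinPoset n) where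
  open FinPoset P renaming (refl to ≤-refl; trans to ≤-trans)

  ≡⇒≤ : ∀ {x y} → x ≡ y → x ≤ y
  ≡⇒≤ refl = ≤-refl _

  ≤-isPartialOrder : IsPartialOrder _≡_ _≤_
  ≤-isPartialOrder = record
    { isPreorder = record
      { isEquivalence = isEquivalence
      ; reflexive     = ≡⇒≤
      ; trans         = ≤-trans
      }
    ; antisym = antisym
    }

  ⋖⇒≤ : ∀ {x y} → x ⋖ y → x ≤ y
  ⋖⇒≤ x⋖y = proj₁ (proj₁ x⋖y)

  <∧¬⋖⇒∃-between : ∀ {x y} → x < y → ¬ x ⋖ y → ∃ λ z → x < z × z < y
  <∧¬⋖⇒∃-between {x} {y} x<y ¬x⋖y =
    let z , ¬¬between = ¬∀⟶∃¬ n (λ z → ¬ (x < z × z < y)) (λ z → ¬? (between? z))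
                          (λ noBetween → ¬x⋖y (x<y , noBetween))
    in z , decidable-stable (between? z) ¬¬between
    where
      between? : ∀ z → Dec (x < z × z < y)
      between? z = (x <? z) ×-dec (z <? y)

  <⇒∃-lower-cover : ∀ {x y} → x < y → ∃ λ z → x ≤ z × z ⋖ y
  <⇒∃-lower-cover {x} = go (po-noetherian ≤-isPartialOrder x)
    where
      go : ∀ {x y} → Acc (flip _<_) x → x < y → ∃ λ z → x ≤ z × z ⋖ y
      go {x} {y} (acc larger) x<y with x ⋖? y
      ... | yes x⋖y = x , ≤-refl x , x⋖y
      ... | no ¬x⋖y with <∧¬⋖⇒∃-between x<y ¬x⋖y
      ...   | w , x<w , w<y with go (larger x<w) w<y
      ...     | z , w≤z , z⋖y = z , ≤-trans (proj₁ x<w) w≤z , z⋖y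

  ≤⇒⋖* : ∀ {x y} → x ≤ y → Star _⋖_ x y
  ≤⇒⋖* {y = y} = go (po-wellFounded ≤-isPartialOrder y)
    where
      go : ∀ {x y} → Acc _<_ y → x ≤ y → Star _⋖_ x y
      go {x} {y} (acc smaller) x≤y with x ≟F y
      ... | yes refl = ε
      ... | no x≢y with <⇒∃-lower-cover (x≤y , x≢y)
      ...   | z , x≤z , z⋖y = go (smaller (proj₁ z⋖y)) x≤z ◅◅ (z⋖y ◅ ε)

  ⋖-monotone⇒monotone : (f : Fin n → Fin n) → (∀ {x y} → x ⋖ y → f x ≤ f y) →
                        ∀ {x y} → x ≤ y → f x ≤ f y
  ⋖-monotone⇒monotone f f-⋖ x≤y =
    fold (λ x y → f x ≤ f y) (λ x⋖y fy≤fz → ≤-trans (f-⋖ x⋖y) fy≤fz) (λ {x} → ≤-refl (f x))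
      (≤⇒⋖* x≤y)

module SpecialMatching {n : ℕ} (P : FinPoset n) (one : Fin n)
                       (M : Fin n → Fin n) (spm : IsSPM P one M) where
  open FinPoset P renaming (refl to ≤-refl; trans to ≤-trans)
  open IsSPM spm
  open Covers P

  up : Fin n → Fin n
  up x with x ⋖? M x
  ... | yes _ = M x
  ... | no  _ = x

  down : Fin n → Fin n
  down x with M x ⋖? x
  ... | yes _ = M x
  ... | no  _ = x

  ¬⋖M⇒M≤ : ∀ x → ¬ x ⋖ M x → M x ≤ x
  ¬⋖M⇒M≤ x ¬x⋖Mx with trichot x
  ... | inj₁ Mx⋖x        = ⋖⇒≤ Mx⋖x
  ... | inj₂ (inj₁ Mx≡x) = ≡⇒≤ Mx≡x
  ... | inj₂ (inj₂ x⋖Mx) = ⊥-elim (¬x⋖Mx x⋖Mx)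

  ¬M⋖⇒≤M : ∀ x → ¬ M x ⋖ x → x ≤ M x
  ¬M⋖⇒≤M x ¬Mx⋖x with trichot x
  ... | inj₁ Mx⋖x        = ⊥-elim (¬Mx⋖x Mx⋖x)
  ... | inj₂ (inj₁ Mx≡x) = ≡⇒≤ (sym Mx≡x)
  ... | inj₂ (inj₂ x⋖Mx) = ⋖⇒≤ x⋖Mx

  ≤up : ∀ x → x ≤ up x
  ≤up x with x ⋖? M x
  ... | yes x⋖Mx = ⋖⇒≤ x⋖Mx
  ... | no  _    = ≤-refl x

  M≤up : ∀ x → M x ≤ up x
  M≤up x with x ⋖? M x
  ... | yes _     = ≤-refl (M x)
  ... | no ¬x⋖Mx = ¬⋖M⇒M≤ x ¬x⋖Mx

  up-least : ∀ {x z} → x ≤ z → M x ≤ z → up x ≤ z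
  up-least {x} x≤z Mx≤z with x ⋖? M x
  ... | yes _ = Mx≤z
  ... | no  _ = x≤z

  down≤ : ∀ x → down x ≤ x
  down≤ x with M x ⋖? x
  ... | yes Mx⋖x = ⋖⇒≤ Mx⋖x
  ... | no  _    = ≤-refl x

  down≤M : ∀ x → down x ≤ M x
  down≤M x with M x ⋖? x
  ... | yes _     = ≤-refl (M x)
  ... | no ¬Mx⋖x = ¬M⋖⇒≤M x ¬Mx⋖x

  down-greatest : ∀ {x z} → z ≤ x → z ≤ M x → z ≤ down x
  down-greatest {x} z≤x z≤Mx with M x ⋖? x
  ... | yes _ = z≤Mx
  ... | no  _ = z≤x

  up-⋖-monotone : ∀ {x y} → x ⋖ y → up x ≤ up y
  up-⋖-monotone {x} {y} x⋖y with M x ≟F y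
  ... | yes Mx≡y = ≤-trans (up-least (⋖⇒≤ x⋖y) (≡⇒≤ Mx≡y)) (≤up y)
  ... | no  Mx≢y = up-least (≤-trans (⋖⇒≤ x⋖y) (≤up y))
                            (≤-trans (proj₁ (special x y x⋖y Mx≢y)) (M≤up y))

  down-⋖-monotone : ∀ {x y} → x ⋖ y → down x ≤ down y
  down-⋖-monotone {x} {y} x⋖y with M x ≟F y
  ... | yes Mx≡y = down-greatest (≤-trans (down≤ x) (⋖⇒≤ x⋖y))
                     (≤-trans (down≤ x) (≡⇒≤ (trans (sym (involution x)) (cong M Mx≡y))))
  ... | no  Mx≢y = down-greatest (≤-trans (down≤ x) (⋖⇒≤ x⋖y))
                     (≤-trans (down≤M x) (proj₁ (special x y x⋖y Mx≢y)))

  up-monotone : ∀ {x y} → x ≤ y → up x ≤ up y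
  up-monotone = ⋖-monotone⇒monotone up up-⋖-monotone

  down-monotone : ∀ {x y} → x ≤ y → down x ≤ down y
  down-monotone = ⋖-monotone⇒monotone down down-⋖-monotone

  up-M-of-lower-cover : ∀ {x} → M x ⋖ x → up (M x) ≡ x
  up-M-of-lower-cover {x} Mx⋖x with M x ⋖? M (M x)
  ... | yes _        = involution x
  ... | no ¬Mx⋖MMx = ⊥-elim (¬Mx⋖MMx (subst (M x ⋖_) (sym (involution x)) Mx⋖x))

  down-view : ∀ x → (M x ⋖ x × down x ≡ M x) ⊎ down x ≡ x
  down-view x with M x ⋖? x
  ... | yes Mx⋖x = inj₁ (Mx⋖x , refl)
  ... | no  _    = inj₂ refl

  down-one : down one ≡ M one
  down-one with M one ⋖? one
  ... | yes _    = refl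
  ... | no ¬top = ⊥-elim (¬top top)

  down≤M-one : IsMaximum one → ∀ x → down x ≤ M one
  down≤M-one isMax x = subst (down x ≤_) down-one (down-monotone (isMax x))

module ProjectionProperties {n : ℕ} (P : FinPoset n) (one : Fin n)
                            (isMax : FinPoset.IsMaximum P one)
                            (M : Fin n → Fin n) (spm : IsSPM P one M) where
  open FinPoset P renaming (refl to ≤-refl; trans to ≤-trans)
  open Projection P M one
  open SpecialMatching P one M spm

  π-β : ∀ p (p≤M1 : p ≤ M one) → π ((p , p≤M1) , β) ≡ up p
  π-β p _ with p ⋖? M p
  ... | yes _ = refl
  ... | no  _ = refl

  π-monotone : ∀ {x y} → x ≤Q y → π x ≤ π y
  π-monotone {(p , _) , α} {(q , _) , α} (p≤q , α≤α) = p≤q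
  π-monotone {(p , _) , α} {(q , hq) , β} (p≤q , α≤β) =
    ≤-trans p≤q (subst (q ≤_) (sym (π-β q hq)) (≤up q))
  π-monotone {(p , hp) , β} {(q , hq) , β} (p≤q , β≤β) =
    subst₂ _≤_ (sym (π-β p hp)) (sym (π-β q hq)) (up-monotone p≤q)

  -- The bound on down x is an argument so that matching on M x ⋖? x unfolds it.
  π-over-down : ∀ x (down≤M1 : down x ≤ M one) → Σ Two λ γ → π ((down x , down≤M1) , γ) ≡ x
  π-over-down x down≤M1 with M x ⋖? x
  ... | yes Mx⋖x = β , trans (π-β (M x) down≤M1) (up-M-of-lower-cover Mx⋖x)
  ... | no  _    = α , refl

  π-lift : ∀ x' y' → x' ≤ y' → Σ Q λ x → Σ Q λ y → x ≤Q y × π x ≡ x' × π y ≡ y'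
  π-lift x' y' x'≤y' with y' ≤? M one
  ... | yes y'≤M1 = ((x' , ≤-trans x'≤y' y'≤M1) , α) , ((y' , y'≤M1) , α) , (x'≤y' , α≤α) , refl , refl
  ... | no y'≰M1 with down-view y'
  ...   | inj₂ down≡y' = ⊥-elim (y'≰M1 (subst (_≤ M one) down≡y' (down≤M-one isMax y')))
  ...   | inj₁ (My'⋖y' , down≡My') =
            ((down x' , down≤M-one isMax x') , γ) , ((M y' , My'≤M1) , β) ,
            (subst (down x' ≤_) down≡My' (down-monotone x'≤y') , ≤₂β γ) ,
            πx≡x' , trans (π-β (M y') My'≤M1) (up-M-of-lower-cover My'⋖y')
    where
      My'≤M1 : M y' ≤ M one
      My'≤M1 = subst (_≤ M one) down≡My' (down≤M-one isMax y')
      γ    = proj₁ (π-over-down x' (down≤M-one isMax x'))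
      πx≡x' = proj₂ (π-over-down x' (down≤M-one isMax x'))

  π-orderProjection : IsOrderProjection P _≤Q_ π
  π-orderProjection = record { monotone = π-monotone ; lift = π-lift }

  π-fibre-nonempty : ∀ x' → Σ Q (Fibre π x')
  π-fibre-nonempty x' = let x , _ , _ , πx≡x' , _ = π-lift x' x' (≤-refl x') in x , πx≡x'

  π-fibresFaithful : FibresFaithful π
  π-fibresFaithful = record
    { nonempty = π-fibre-nonempty
    ; distinct = λ x' y' x'⊆y' →
        let q , πq≡x' = π-fibre-nonempty x' in trans (sym πq≡x') (x'⊆y' q πq≡x')
    }

  π-fibreIso : FibreIso P _≤Q_ π
  π-fibreIso = record
    { to      = λ x → x
    ; from    = λ x → x
    ; from-to = λ _ → refl
    ; to-from = λ _ → refl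
    ; to-mono = λ x y x≤y →
        let a , b , a≤b , πa≡x , πb≡y = π-lift x y x≤y in a , b , πa≡x , πb≡y , a≤b
    ; to-refl = λ { x y (a , b , πa≡x , πb≡y , a≤b) → subst₂ _≤_ πa≡x πb≡y (π-monotone a≤b) }
    }

lemma5p3 : ∀ {n} (P : FinPoset n) (zero one : Fin n) →
    FinPoset.IsMinimum P zero → FinPoset.IsMaximum P one →
    (M : Fin n → Fin n) → IsSPM P one M →
    IsOrderProjection P (Projection._≤Q_ P M one) (Projection.π P M one)
    × FibresFaithful (Projection.π P M one)
    × FibreIso P (Projection._≤Q_ P M one) (Projection.π P M one)
lemma5p3 P _ one _ isMax M spm =
  π-orderProjection , π-fibresFaithful , π-fibreIso
  where open ProjectionProperties P one isMax M spm
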